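{- Let $G$ be a chordal graph such that no connected component of $G$ is a clique and $G$ has no bridge. Then every maximal clique in $G$ has size at least three.
   Context: A graph is chordal if every cycle of length at least four has a chord. A bridge is an edge contained in no cycle. (A single vertex or a single edge component counts as a clique component.) -}

module Defs where

open import Data.Nat using (ℕ; zero; suc; _≤_; _<_)
open import Data.Fin using (Fin; toℕ)
open import Data.Fin.Subset using (Subset; _∈_; _∉_; _⊆_; ∣_∣)
open import Data.Bool using (Bool; true; false)
open import Data.Product using (Σ; ∃; _×_; _,_)
open import Data.Sum using (_⊎_)
open import Relation.Nullary using (¬_)
open import Relation.Binary.PropositionalEquality using (_≡_; _≢_)
open import Function.Definitions using (Injective)

record SimpleGraph (n : ℕ) : Set where
  field
    adj    : Fin n → Fin n → Bool
    sym    : ∀ u v → adj u v ≡ adj v u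
    irrefl : ∀ v → adj v v ≡ false

module _ {n : ℕ} (G : SimpleGraph n) where
  open SimpleGraph G

  Adj : Fin n → Fin n → Set
  Adj u v = adj u v ≡ true

  -- positions i, j of a cyclic sequence of length k are consecutive (j follows i)
  Consec : {k : ℕ} → Fin k → Fin k → Set
  Consec {k} i j = (suc (toℕ i) ≡ toℕ j) ⊎ ((suc (toℕ i) ≡ k) × (toℕ j ≡ 0))

  record Cycle (k : ℕ) : Set where
    field
      len≥3  : 3 ≤ k
      vert   : Fin k → Fin n
      inj    : Injective _≡_ _≡_ vert
      edges  : ∀ i j → Consec i j → Adj (vert i) (vert j)

  HasChord : {k : ℕ} → Cycle k → Set
  HasChord {k} C = Σ (Fin k) λ i → Σ (Fin k) λ j →
    Adj (Cycle.vert C i) (Cycle.vert C j) × ¬ Consec i j × ¬ Consec j i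

  Chordal : Set
  Chordal = ∀ k (C : Cycle k) → 4 ≤ k → HasChord C

  EdgeOnCycle : Fin n → Fin n → Set
  EdgeOnCycle u v = Σ ℕ λ k → Σ (Cycle k) λ C → Σ (Fin k) λ i → Σ (Fin k) λ j →
    Consec i j ×
    ((Cycle.vert C i ≡ u × Cycle.vert C j ≡ v) ⊎ (Cycle.vert C i ≡ v × Cycle.vert C j ≡ u))

  IsBridge : Fin n → Fin n → Set
  IsBridge u v = Adj u v × ¬ EdgeOnCycle u v

  NoBridge : Set
  NoBridge = ∀ u v → ¬ IsBridge u v

  data Reach : Fin n → Fin n → Set where
    here : ∀ {u} → Reach u u
    step : ∀ {u v w} → Adj u v → Reach v w → Reach u w

  ComponentIsClique : Fin n → Set
  ComponentIsClique x = ∀ y z → Reach x y → Reach x z → y ≢ z → Adj y z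

  NoCliqueComponent : Set
  NoCliqueComponent = ∀ x → ¬ ComponentIsClique x

  IsClique : Subset n → Set
  IsClique S = ∀ u v → u ∈ S → v ∈ S → u ≢ v → Adj u v

  IsMaximalClique : Subset n → Set
  IsMaximalClique S = IsClique S × (∀ T → IsClique T → S ⊆ T → T ⊆ S)

-- In a chordal graph every edge on a cycle lies in a triangle: a chord of a cycle of length at
-- least four cuts off a shorter cycle through the same edge, so a shortest such cycle is a
-- triangle. A maximal clique S with at most two vertices would then absorb a further vertex
-- adjacent to all of S: any vertex if S is empty, a neighbour if S is a single vertex (whose
-- component is not a clique, so it has one), and the apex of a triangle on the edge if S is an
-- edge (which lies on a cycle, not being a bridge).
module Submission where

open import Defs
open import Data.Nat using (ℕ; zero; suc; _+_; _∸_; _≤_; _<_; z≤n; s≤s; z<s)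
open import Data.Nat.Properties
open import Data.Nat.DivMod using (_mod_; m<n⇒m%n≡m)
open import Data.Nat.Induction using (<-rec)
open import Data.Fin using (Fin; toℕ) renaming (zero to fzero)
open import Data.Fin.Properties using (toℕ-injective; toℕ<n; toℕ-fromℕ<; any?) renaming (_≟_ to _≟ᶠ_)
open import Data.Fin.Subset using (Subset; ∣_∣; _∈_; ⁅_⁆; _∪_)
open import Data.Fin.Subset.Properties
  using (_∈?_; x∈⁅x⁆; x∈⁅y⁆⇒x≡y; x∈p∪q⁻; x∈p∪q⁺; p⊆p∪q; x∈p∧x≢y⇒x∈p-y; x∈p⇒∣p-x∣<∣p∣)
open import Data.Bool using (true)
open import Data.Bool.Properties using () renaming (_≟_ to _≟ᵇ_)
open import Data.List using (List; []; _∷_; length)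
open import Data.List.Relation.Unary.All using (All; []; _∷_; lookup; zipWith)
open import Data.List.Relation.Unary.Any using (here) renaming (any? to anyˡ?)
open import Data.List.Membership.Propositional using () renaming (_∈_ to _∈ˡ_; _∉_ to _∉ˡ_)
open import Data.List.Relation.Unary.All.Properties.Core using (¬Any⇒All¬)
open import Data.List.Relation.Unary.Unique.Propositional using (Unique; []; _∷_)
open import Data.Product using (∃; _×_; _,_)
open import Data.Sum using (_⊎_; inj₁; inj₂)
open import Data.Empty using (⊥-elim)
open import Function using (_∘_; _$_)
open import Relation.Nullary using (¬_; yes; no; contradiction; ¬?; _×-dec_)
open import Relation.Nullary.Decidable using (decidable-stable)
open import Relation.Binary.PropositionalEquality
open import Relation.Binary using (tri<; tri≈; tri>)
open import Algebra.Properties.CommutativeSemigroup +-commutativeSemigroup using (xy∙z≈xz∙y)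

skip : ℕ → ℕ → ℕ → ℕ
skip a d t with t ≤? a
... | yes _ = t
... | no  _ = t + d

module _ {a d : ℕ} where

  skip-≤ : ∀ {t} → t ≤ a → skip a d t ≡ t
  skip-≤ {t} t≤a with t ≤? a
  ... | yes _   = refl
  ... | no  t≰a = contradiction t≤a t≰a

  skip-> : ∀ {t} → a < t → skip a d t ≡ t + d
  skip-> {t} a<t with t ≤? a
  ... | yes t≤a = contradiction t≤a (<⇒≱ a<t)
  ... | no  _   = refl

  skip-injective : ∀ {s t} → skip a d s ≡ skip a d t → s ≡ t
  skip-injective {s} {t} eq with ≤-<-connex s a | ≤-<-connex t a
  ... | inj₁ s≤a | inj₁ t≤a = trans (sym (skip-≤ s≤a)) (trans eq (skip-≤ t≤a))
  ... | inj₂ a<s | inj₂ a<t = +-cancelʳ-≡ d s t (trans (sym (skip-> a<s)) (trans eq (skip-> a<t)))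
  ... | inj₁ s≤a | inj₂ a<t = contradiction (m+n≤o⇒m≤o t (subst (_≤ a) e s≤a)) (<⇒≱ a<t)
    where e = trans (sym (skip-≤ s≤a)) (trans eq (skip-> a<t))
  ... | inj₂ a<s | inj₁ t≤a = contradiction (m+n≤o⇒m≤o s (subst (_≤ a) e t≤a)) (<⇒≱ a<s)
    where e = trans (sym (skip-≤ t≤a)) (trans (sym eq) (skip-> a<s))

-- wrap r s reads the positions 0, …, suc r + s cyclically, starting from suc r.
wrap : ℕ → ℕ → ℕ → ℕ
wrap r s t with t ≤? s
... | yes _ = suc r + t
... | no  _ = t ∸ suc s

module _ {r s : ℕ} where

  wrap-≤ : ∀ {t} → t ≤ s → wrap r s t ≡ suc r + t
  wrap-≤ {t} t≤s with t ≤? s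
  ... | yes _   = refl
  ... | no  t≰s = contradiction t≤s t≰s

  wrap-> : ∀ {t} → s < t → wrap r s t ≡ t ∸ suc s
  wrap-> {t} s<t with t ≤? s
  ... | yes t≤s = contradiction t≤s (<⇒≱ s<t)
  ... | no  _   = refl

  wrap-bounded : ∀ {t} → t ≤ suc r + s → wrap r s t ≤ suc r + s
  wrap-bounded {t} t≤m with ≤-<-connex t s
  ... | inj₁ t≤s = subst (_≤ suc r + s) (sym (wrap-≤ t≤s)) (+-monoʳ-≤ (suc r) t≤s)
  ... | inj₂ s<t = subst (_≤ suc r + s) (sym (wrap-> s<t)) (≤-trans (m∸n≤m t (suc s)) t≤m)

  wrap-low≢high : ∀ {t u} → u ≤ suc r + s → suc r + t ≢ u ∸ suc s
  wrap-low≢high {t} {u} u≤m e = 1+n≰n (begin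
    suc r      ≤⟨ m≤m+n (suc r) t ⟩
    suc r + t  ≡⟨ e ⟩
    u ∸ suc s  ≤⟨ ∸-monoˡ-≤ (suc s) u≤m ⟩
    r + s ∸ s  ≡⟨ m+n∸n≡m r s ⟩
    r          ∎)
    where open ≤-Reasoning

  wrap-injective : ∀ {t u} → t ≤ suc r + s → u ≤ suc r + s → wrap r s t ≡ wrap r s u → t ≡ u
  wrap-injective {t} {u} t≤m u≤m eq with ≤-<-connex t s | ≤-<-connex u s
  ... | inj₁ t≤s | inj₁ u≤s = +-cancelˡ-≡ (suc r) t u (trans (sym (wrap-≤ t≤s)) (trans eq (wrap-≤ u≤s)))
  ... | inj₂ s<t | inj₂ s<u = ∸-cancelʳ-≡ s<t s<u (trans (sym (wrap-> s<t)) (trans eq (wrap-> s<u)))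
  ... | inj₁ t≤s | inj₂ s<u = ⊥-elim (wrap-low≢high u≤m (trans (sym (wrap-≤ t≤s)) (trans eq (wrap-> s<u))))
  ... | inj₂ s<t | inj₁ u≤s = ⊥-elim (wrap-low≢high t≤m (trans (sym (wrap-≤ u≤s)) (trans (sym eq) (wrap-> s<t))))

Unique∧All∈⇒length≤∣p∣ : ∀ {n} {p : Subset n} {xs} → Unique xs → All (_∈ p) xs → length xs ≤ ∣ p ∣
Unique∧All∈⇒length≤∣p∣ [] [] = z≤n
Unique∧All∈⇒length≤∣p∣ (x≢xs ∷ unique) (x∈p ∷ xs∈p) =
  ≤-trans (s≤s (Unique∧All∈⇒length≤∣p∣ unique xs∈p-x)) (x∈p⇒∣p-x∣<∣p∣ x∈p)
  where
  xs∈p-x = zipWith (λ (x≢y , y∈p) → x∈p∧x≢y⇒x∈p-y y∈p (x≢y ∘ sym)) (x≢xs , xs∈p)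

covered-or-new : ∀ {n} (p : Subset n) (xs : List (Fin n)) → (∀ {x} → x ∈ p → x ∈ˡ xs) ⊎ ∃ λ x → x ∈ p × x ∉ˡ xs
covered-or-new p xs with any? (λ x → x ∈? p ×-dec ¬? (anyˡ? (x ≟ᶠ_) xs))
... | yes new  = inj₂ new
... | no  none = inj₁ λ {x} x∈p → decidable-stable (anyˡ? (x ≟ᶠ_) xs) (λ x∉xs → none (x , x∈p , x∉xs))

module _ {n : ℕ} (G : SimpleGraph n) where
  open SimpleGraph G using (adj) renaming (sym to adj-sym-bool; irrefl to adj-irrefl-bool)

  adj-sym : ∀ {u v} → Adj G u v → Adj G v u
  adj-sym {u} {v} uv = trans (adj-sym-bool v u) uv

  adj-irrefl : ∀ {u} → ¬ Adj G u u
  adj-irrefl {u} uu with trans (sym uu) (adj-irrefl-bool u)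
  ... | ()

  adj⇒≢ : ∀ {u v} → Adj G u v → u ≢ v
  adj⇒≢ uv refl = adj-irrefl uv

  CommonNeighbour : Fin n → Fin n → Set
  CommonNeighbour u v = ∃ λ w → Adj G u w × Adj G v w

  common-neighbour-sym : ∀ {u v} → CommonNeighbour u v → CommonNeighbour v u
  common-neighbour-sym (w , uw , vw) = w , vw , uw

  -- Only vertex 0, …, vertex m belong to the path; the values of vertex beyond m are junk.
  record Path (u v : Fin n) (m : ℕ) : Set where
    field
      vertex   : ℕ → Fin n
      start    : vertex 0 ≡ u
      end      : vertex m ≡ v
      adjacent : ∀ {t} → t < m → Adj G (vertex t) (vertex (suc t))
      distinct : ∀ {s t} → s ≤ m → t ≤ m → vertex s ≡ vertex t → s ≡ t

  open Path

  AdjAt : ∀ {u v m} → Path u v m → ℕ → ℕ → Set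
  AdjAt P i j = Adj G (vertex P i) (vertex P j)

  close : ∀ {u v m} → Path u v m → 2 ≤ m → Adj G v u → Cycle G (suc m)
  close {m = m} P 2≤m vu = record
    { len≥3 = s≤s 2≤m
    ; vert  = vertex P ∘ toℕ
    ; inj   = λ {i} {j} → toℕ-injective ∘ distinct P (≤-pred (toℕ<n i)) (≤-pred (toℕ<n j))
    ; edges = edge
    }
    where
    edge : ∀ i j → Consec G i j → AdjAt P (toℕ i) (toℕ j)
    edge i j (inj₁ e)         = subst (Adj G _ ∘ vertex P) e (adjacent P (subst (_≤ m) (sym e) (≤-pred (toℕ<n j))))
    edge i j (inj₂ (e₁ , e₂)) = subst₂ (AdjAt P) (sym (suc-injective e₁)) (sym e₂)
                                  (subst₂ (Adj G) (sym (end P)) (sym (start P)) vu)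

  shortcut : ∀ {u v} a d r (P : Path u v (suc a + d + r)) → AdjAt P a (suc a + d) → Path u v (suc a + r)
  shortcut a d r P chord = record
    { vertex   = vertex P ∘ skip a d
    ; start    = trans (cong (vertex P) (skip-≤ {a} {d} z≤n)) (start P)
    ; end      = trans (cong (vertex P) (trans (skip-> {a} {d} a<m) (xy∙z≈xz∙y (suc a) r d))) (end P)
    ; adjacent = edge
    ; distinct = λ s≤m t≤m → skip-injective ∘ distinct P (bounded s≤m) (bounded t≤m)
    }
    where
    a<m : a < suc a + r
    a<m = s≤s (m≤m+n a r)

    a<m+d : a < suc a + d + r
    a<m+d = ≤-trans (m≤m+n (suc a) d) (m≤m+n (suc a + d) r)

    bounded : ∀ {t} → t ≤ suc a + r → skip a d t ≤ suc a + d + r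
    bounded {t} t≤m with ≤-<-connex t a
    ... | inj₁ t≤a = subst (_≤ suc a + d + r) (sym (skip-≤ t≤a)) (≤-trans t≤a (<⇒≤ a<m+d))
    ... | inj₂ a<t = subst₂ _≤_ (sym (skip-> a<t)) (xy∙z≈xz∙y (suc a) r d) (+-monoˡ-≤ d t≤m)

    edge : ∀ {t} → t < suc a + r → AdjAt P (skip a d t) (skip a d (suc t))
    edge {t} t<m with <-cmp t a
    ... | tri< t<a _ _ = subst₂ (AdjAt P) (sym (skip-≤ (<⇒≤ t<a))) (sym (skip-≤ t<a))
                           (adjacent P (<-trans t<a a<m+d))
    ... | tri≈ _ refl _ = subst₂ (AdjAt P) (sym (skip-≤ {a} {d} ≤-refl)) (sym (skip-> {a} {d} ≤-refl)) chord
    ... | tri> _ _ a<t = subst₂ (AdjAt P) (sym (skip-> a<t)) (sym (skip-> (m<n⇒m<1+n a<t)))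
                           (adjacent P (subst (suc t + d ≤_) (xy∙z≈xz∙y (suc a) r d) (+-monoˡ-≤ d t<m)))

  rotate : ∀ {u v m r} (P : Path u v m) → Adj G v u → r < m → Path (vertex P (suc r)) (vertex P r) m
  rotate {m = m} {r} P vu r<m with m≤n⇒∃[o]m+o≡n r<m
  ... | s , refl = record
    { vertex   = vertex P ∘ wrap r s
    ; start    = cong (vertex P) (trans (wrap-≤ {r} {s} z≤n) (+-identityʳ (suc r)))
    ; end      = cong (vertex P) (trans (wrap-> (s≤s (m≤n+m s r))) (m+n∸n≡m r s))
    ; adjacent = edge
    ; distinct = λ t≤m u≤m → wrap-injective t≤m u≤m ∘ distinct P (wrap-bounded t≤m) (wrap-bounded u≤m)
    }
    where
    edge : ∀ {t} → t < suc r + s → AdjAt P (wrap r s t) (wrap r s (suc t))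
    edge {t} t<m with <-cmp t s
    ... | tri< t<s _ _ = subst₂ (AdjAt P) (sym (wrap-≤ (<⇒≤ t<s))) (sym (trans (wrap-≤ t<s) (+-suc (suc r) t)))
                           (adjacent P (+-monoʳ-< (suc r) t<s))
    ... | tri≈ _ refl _ = subst₂ (AdjAt P) (sym (wrap-≤ {r} {s} ≤-refl)) (sym (trans (wrap-> {r} {s} ≤-refl) (n∸n≡0 s)))
                            (subst₂ (Adj G) (sym (end P)) (sym (start P)) vu)
    ... | tri> _ _ s<t = subst₂ (AdjAt P) (sym (wrap-> s<t)) (sym (trans (wrap-> (m<n⇒m<1+n s<t)) (+-∸-assoc 1 s<t)))
                           (adjacent P (subst (_≤ suc r + s) (+-∸-assoc 1 s<t) (≤-trans (m∸n≤m t s) (<⇒≤ t<m))))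

  ShorterPath : Fin n → Fin n → ℕ → Set
  ShorterPath u v m = ∃ λ m′ → 2 ≤ m′ × m′ < m × Path u v m′

  chord-shortens : ∀ {u v m x y} (P : Path u v m) → x < y → y ≤ m → suc x ≢ y → ¬ (x ≡ 0 × y ≡ m) →
                   AdjAt P x y → ShorterPath u v m
  chord-shortens {x = x} P x<y y≤m x+1≢y not-closing chord with m≤n⇒∃[o]m+o≡n x<y | m≤n⇒∃[o]m+o≡n y≤m
  ... | d , refl | r , refl = suc x + r , long , +-monoˡ-< r (m<m+n (suc x) (n≢0⇒n>0 d≢0)) , shortcut x d r P chord
    where
    d≢0 : d ≢ 0
    d≢0 d≡0 = x+1≢y (sym (trans (cong (suc x +_) d≡0) (+-identityʳ (suc x))))

    long : 2 ≤ suc x + r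
    long = s≤s (n≢0⇒n>0 λ x+r≡0 → not-closing
      (m+n≡0⇒m≡0 x x+r≡0 , sym (trans (cong (suc x + d +_) (m+n≡0⇒n≡0 x x+r≡0)) (+-identityʳ (suc x + d)))))

  chordal-shortens : Chordal G → ∀ {u v m} → 3 ≤ m → Path u v m → Adj G v u → ShorterPath u v m
  chordal-shortens chordal {m = m} 3≤m P vu with chordal (suc m) (close P (≤-trans (n≤1+n 2) 3≤m) vu) (s≤s 3≤m)
  ... | i , j , ij , ¬i→j , ¬j→i with <-cmp (toℕ i) (toℕ j)
  ...   | tri< i<j _ _ = chord-shortens P i<j (≤-pred (toℕ<n j)) (¬i→j ∘ inj₁)
                           (λ (i≡0 , j≡m) → ¬j→i (inj₂ (cong suc j≡m , i≡0))) ij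
  ...   | tri≈ _ i≡j _ = ⊥-elim (adj⇒≢ ij (cong (vertex P) i≡j))
  ...   | tri> _ _ j<i = chord-shortens P j<i (≤-pred (toℕ<n i)) (¬j→i ∘ inj₁)
                           (λ (j≡0 , i≡m) → ¬i→j (inj₂ (cong suc i≡m , j≡0))) (adj-sym ij)

  closing-edge-in-triangle : Chordal G → ∀ m {u v} → 2 ≤ m → Path u v m → Adj G v u → CommonNeighbour u v
  closing-edge-in-triangle chordal = <-rec Closes closes
    where
    Closes : ℕ → Set
    Closes m = ∀ {u v} → 2 ≤ m → Path u v m → Adj G v u → CommonNeighbour u v

    closes : ∀ m → (∀ {m′} → m′ < m → Closes m′) → Closes m
    closes (suc zero) _ (s≤s ())
    closes (suc (suc zero)) _ _ P vu =
      vertex P 1 , subst (λ x → Adj G x _) (start P) (adjacent P z<s)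
                 , subst (λ x → Adj G x _) (end P) (adj-sym (adjacent P ≤-refl))
    closes (suc (suc (suc m))) shorter _ P vu with chordal-shortens chordal (s≤s (s≤s (s≤s z≤n))) P vu
    ... | m′ , 2≤m′ , m′<m , Q = shorter m′<m 2≤m′ Q vu

  -- t mod suc K is used only as a total map ℕ → Fin (suc K) that is the identity below suc K.
  module _ {K : ℕ} (C : Cycle G (suc K)) where
    open Cycle C

    toℕ-mod : ∀ {t} → t < suc K → toℕ (t mod suc K) ≡ t
    toℕ-mod t<k = trans (toℕ-fromℕ< _) (m<n⇒m%n≡m t<k)

    mod-toℕ : ∀ {i : Fin (suc K)} {t} → toℕ i ≡ t → t mod suc K ≡ i
    mod-toℕ {i} refl = toℕ-injective (toℕ-mod (toℕ<n i))

    unroll : Path (vert (0 mod suc K)) (vert (K mod suc K)) K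
    unroll = record
      { vertex   = λ t → vert (t mod suc K)
      ; start    = refl
      ; end      = refl
      ; adjacent = λ {t} t<K → edges _ _ (inj₁ (trans (cong suc (toℕ-mod (m<n⇒m<1+n t<K))) (sym (toℕ-mod (s≤s t<K)))))
      ; distinct = λ s≤K t≤K e → trans (sym (toℕ-mod (s≤s s≤K))) (trans (cong toℕ (inj e)) (toℕ-mod (s≤s t≤K)))
      }

    unroll-closes : Adj G (vert (K mod suc K)) (vert (0 mod suc K))
    unroll-closes = edges _ _ (inj₂ (cong suc (toℕ-mod ≤-refl) , toℕ-mod z<s))

  cycle-edge-in-triangle : Chordal G → ∀ {k} (C : Cycle G k) {i j} → Consec G i j →
                           CommonNeighbour (Cycle.vert C i) (Cycle.vert C j)
  cycle-edge-in-triangle chordal {suc K} C {i} {j} (inj₁ i+1≡j) = common-neighbour-sym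
    (subst₂ CommonNeighbour (cong vert (mod-toℕ C (sym i+1≡j))) (cong vert (mod-toℕ C refl))
      (closing-edge-in-triangle chordal K (≤-pred len≥3)
        (rotate (unroll C) (unroll-closes C) i<K) (adjacent (unroll C) i<K)))
    where
    open Cycle C
    i<K : toℕ i < K
    i<K = subst (_≤ K) (sym i+1≡j) (≤-pred (toℕ<n j))
  cycle-edge-in-triangle chordal {suc K} C {i} {j} (inj₂ (i+1≡k , j≡0)) = common-neighbour-sym
    (subst₂ CommonNeighbour (cong vert (mod-toℕ C j≡0)) (cong vert (mod-toℕ C (suc-injective i+1≡k)))
      (closing-edge-in-triangle chordal K (≤-pred len≥3) (unroll C) (unroll-closes C)))
    where open Cycle C

  edge-on-cycle-in-triangle : Chordal G → ∀ {u v} → EdgeOnCycle G u v → CommonNeighbour u v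
  edge-on-cycle-in-triangle chordal (_ , C , _ , _ , consec , inj₁ (refl , refl)) = cycle-edge-in-triangle chordal C consec
  edge-on-cycle-in-triangle chordal (_ , C , _ , _ , consec , inj₂ (refl , refl)) =
    common-neighbour-sym (cycle-edge-in-triangle chordal C consec)

  isolated-component-is-clique : ∀ {u} → ¬ ∃ (Adj G u) → ComponentIsClique G u
  isolated-component-is-clique {u} isolated y z u⇝y u⇝z y≢z = contradiction (trans (stuck u⇝y) (sym (stuck u⇝z))) y≢z
    where
    stuck : ∀ {y} → Reach G u y → y ≡ u
    stuck here         = refl
    stuck (step uw _) = ⊥-elim (isolated (_ , uw))

  neighbour : ∀ {u} → ¬ ComponentIsClique G u → ∃ (Adj G u)
  neighbour {u} not-clique = decidable-stable (any? λ w → adj u w ≟ᵇ true) (not-clique ∘ isolated-component-is-clique)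

  maximal-clique-absorbs : ∀ {S w} → IsMaximalClique G S → (∀ {x} → x ∈ S → Adj G x w) → w ∈ S
  maximal-clique-absorbs {S} {w} (clique , maximal) S~w =
    maximal (S ∪ ⁅ w ⁆) extended (p⊆p∪q ⁅ w ⁆) (x∈p∪q⁺ (inj₂ (x∈⁅x⁆ w)))
    where
    extended : IsClique G (S ∪ ⁅ w ⁆)
    extended x y x∈ y∈ x≢y with x∈p∪q⁻ S ⁅ w ⁆ x∈ | x∈p∪q⁻ S ⁅ w ⁆ y∈
    ... | inj₁ x∈S | inj₁ y∈S = clique x y x∈S y∈S x≢y
    ... | inj₁ x∈S | inj₂ y∈w = subst (Adj G x) (sym (x∈⁅y⁆⇒x≡y w y∈w)) (S~w x∈S)
    ... | inj₂ x∈w | inj₁ y∈S = subst (λ z → Adj G z y) (sym (x∈⁅y⁆⇒x≡y w x∈w)) (adj-sym (S~w y∈S))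
    ... | inj₂ x∈w | inj₂ y∈w = contradiction (trans (x∈⁅y⁆⇒x≡y w x∈w) (sym (x∈⁅y⁆⇒x≡y w y∈w))) x≢y

  cover-has-no-common-neighbour : ∀ {S xs} → IsMaximalClique G S → (∀ {x} → x ∈ S → x ∈ˡ xs) →
                                  ¬ ∃ λ w → All (λ x → Adj G x w) xs
  cover-has-no-common-neighbour maximal covered (w , xs~w) =
    adj-irrefl (lookup xs~w (covered (maximal-clique-absorbs maximal (lookup xs~w ∘ covered))))

lemma23 : (n : ℕ) → 1 ≤ n → (G : SimpleGraph n) →
    Chordal G → NoCliqueComponent G → NoBridge G →
    (S : Subset n) → IsMaximalClique G S → 3 ≤ ∣ S ∣
lemma23 zero () G
lemma23 (suc n) _ G chordal no-clique-component no-bridge S maximal@(clique , _) with covered-or-new S []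
... | inj₁ S⊆[] = ⊥-elim (cover-has-no-common-neighbour G maximal S⊆[] (fzero , []))
... | inj₂ (u , u∈S , _) with covered-or-new S (u ∷ [])
...   | inj₁ S⊆[u] =
  let w , uw = neighbour G (no-clique-component u)
  in  ⊥-elim (cover-has-no-common-neighbour G maximal S⊆[u] (w , uw ∷ []))
...   | inj₂ (v , v∈S , v∉[u]) with covered-or-new S (v ∷ u ∷ [])
...     | inj₁ S⊆[v,u] = ⊥-elim $ no-bridge v u (clique v u v∈S u∈S (v∉[u] ∘ here) , λ on-cycle →
  let w , vw , uw = edge-on-cycle-in-triangle G chordal on-cycle
  in  cover-has-no-common-neighbour G maximal S⊆[v,u] (w , vw ∷ uw ∷ []))
...     | inj₂ (x , x∈S , x∉[v,u]) =
  Unique∧All∈⇒length≤∣p∣ (¬Any⇒All¬ _ x∉[v,u] ∷ ¬Any⇒All¬ _ v∉[u] ∷ [] ∷ []) (x∈S ∷ v∈S ∷ u∈S ∷ [])
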